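{- For integers $N\ge k\ge 0$, $$\lim_{\lambda\to0}\lambda^{N-k}S_{2,\frac1\lambda}(N,k)=\lim_{\lambda\to0}\lambda^{N-k}B_{N,k}\big((1)_{1,\frac1\lambda},(1)_{2,\frac1\lambda},\dots,(1)_{N-k+1,\frac1\lambda}\big)=S_1(N,k),$$ where the limits are taken over nonzero real $\lambda$.
   Context: For $\mu\ne0$, $(x)_{n,\mu}=x(x-\mu)\cdots(x-(n-1)\mu)$ for $n\ge1$ and $(x)_{0,\mu}=1$. The degenerate Stirling numbers of the second kind are defined by $\frac{1}{k!}\big((1+\mu t)^{1/\mu}-1\big)^k=\sum_{n=k}^\infty S_{2,\mu}(n,k)\frac{t^n}{n!}$ (here $\mu=1/\lambda$). The exponential partial Bell polynomials are $B_{n,k}(x_1,\dots,x_{n-k+1})=\sum\frac{n!}{\prod_{l=1}^{n-k+1}i_l!}\prod_{l=1}^{n-k+1}\left(\frac{x_l}{l!}\right)^{i_l}$, the sum over nonnegative integers $i_1,\dots,i_{n-k+1}$ with $\sum_l i_l=k$ and $\sum_l l\,i_l=n$. The signed Stirling numbers of the first kind $S_1(n,k)$ are defined by $\frac{1}{k!}(\log(1+t))^k=\sum_{n\ge k}S_1(n,k)\frac{t^n}{n!}$.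
   Formalization: The limits as λ → 0 are taken over nonzero rational λ instead of nonzero real λ. -}

module Defs where

open import Data.Nat as ℕ using (ℕ; zero; suc; _≡ᵇ_; _!)
open import Data.Nat.Properties using (_!≢0)
open import Data.Integer as ℤ using (ℤ; +_; -[1+_])
open import Data.Rational as ℚ using (ℚ; 0ℚ; 1ℚ; _+_; _*_; _-_; -_; _<_; _/_; 1/_; NonZero; ∣_∣)
open import Data.List using (List; []; _∷_; map; concatMap; foldr; filter; upTo)
open import Data.Vec as Vec using (Vec; []; _∷_)
open import Data.Bool using (Bool; true; false; if_then_else_)
open import Data.Product using (Σ; _×_; ∃; _,_)
open import Relation.Binary.PropositionalEquality using (_≡_)

infixr 8 _^_
_^_ : ℚ → ℕ → ℚ
x ^ zero = 1ℚ
x ^ suc n = x * (x ^ n)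

ℕ→ℚ : ℕ → ℚ
ℕ→ℚ n = (+ n) / 1

inv! : ℕ → ℚ
inv! n = (+ 1) / (n !)
  where instance _ = n !≢0

sgn : ℕ → ℚ
sgn n = (- 1ℚ) ^ n

Σ< : ℕ → (ℕ → ℚ) → ℚ
Σ< zero f = 0ℚ
Σ< (suc n) f = Σ< n f + f n

dfall : ℚ → ℚ → ℕ → ℚ
dfall μ x zero = 1ℚ
dfall μ x (suc n) = dfall μ x n * (x - ℕ→ℚ n * μ)

-- formal power series in t with rational coefficients: coefficient sequence
Series : Set
Series = ℕ → ℚ

_⊛_ : Series → Series → Series
(f ⊛ g) n = Σ< (suc n) (λ i → f i * g (n ℕ.∸ i))

spow : Series → ℕ → Series
spow f zero zero = 1ℚ
spow f zero (suc n) = 0ℚ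
spow f (suc k) = f ⊛ spow f k

-- (1 + μ t)^{1/μ} - 1 = Σ_{n≥1} (1)_{n,μ} t^n / n!
degExpMinus1 : ℚ → Series
degExpMinus1 μ zero = 0ℚ
degExpMinus1 μ (suc n) = dfall μ 1ℚ (suc n) * inv! (suc n)

S2 : ℚ → ℕ → ℕ → ℚ
S2 μ n k = ℕ→ℚ (n !) * inv! k * spow (degExpMinus1 μ) k n

logSeries : Series
logSeries zero = 0ℚ
logSeries (suc n) = sgn n * ((+ 1) / suc n)

S1 : ℕ → ℕ → ℚ
S1 n k = ℕ→ℚ (n !) * inv! k * spow logSeries k n

boundedVecs : (m b : ℕ) → List (Vec ℕ m)
boundedVecs zero b = [] ∷ []
boundedVecs (suc m) b = concatMap (λ i → map (i ∷_) (boundedVecs m b)) (upTo (suc b))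

vsum : ∀ {m} → Vec ℕ m → ℕ
vsum [] = 0
vsum (i ∷ is) = i ℕ.+ vsum is

wsum : ∀ {m} → ℕ → Vec ℕ m → ℕ
wsum l [] = 0
wsum l (i ∷ is) = l ℕ.* i ℕ.+ wsum (suc l) is

bellTerm : ∀ {m} → (ℕ → ℚ) → ℕ → Vec ℕ m → ℚ
bellTerm x l [] = 1ℚ
bellTerm x l (i ∷ is) = ((x l * inv! l) ^ i) * inv! i * bellTerm x (suc l) is

-- exponential partial Bell polynomial B_{n,k}(x_1,…,x_{n-k+1});
-- x is given as a sequence indexed from 1 (x 0 unused).
-- Sum over (i_1,…,i_{n-k+1}) ∈ ℕ^{n-k+1} with Σ i_l = k and Σ l i_l = n
-- (such i_l are automatically ≤ k, so enumerating entries ≤ k is exhaustive).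
bell : ℕ → ℕ → (ℕ → ℚ) → ℚ
bell n k x =
  foldr _+_ 0ℚ
    (map (λ v → if (vsum v ≡ᵇ k) Data.Bool.∧ (wsum 1 v ≡ᵇ n)
                  then ℕ→ℚ (n !) * bellTerm x 1 v else 0ℚ)
         (boundedVecs (suc (n ℕ.∸ k)) k))
  where import Data.Bool

LimAt0 : ((l : ℚ) → .{{NonZero l}} → ℚ) → ℚ → Set
LimAt0 f L = ∀ (ε : ℚ) → 0ℚ < ε →
  ∃ λ (δ : ℚ) → (0ℚ < δ) ×
    (∀ (l : ℚ) .{{nz : NonZero l}} → ∣ l ∣ < δ → ∣ f l - L ∣ < ε)

module Submission where

-- Put μ = 1/λ. Since λᵐ (1)_{m+1,μ} = (λ - 1)(λ - 2)⋯(λ - m), substituting t ↦ λt in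
-- (1/k!)((1 + μt)^{1/μ} - 1)ᵏ gives λ^{N-k} S_{2,μ}(N,k) = (N!/k!) [t^N] E_λ(t)ᵏ, where
-- E_λ(t) = Σ_{m≥1} (λ - 1)⋯(λ - (m - 1)) tᵐ/m!. The right-hand side is a polynomial in λ,
-- hence Lipschitz at 0, and E_0(t) = Σ_{m≥1} (-1)^{m-1} tᵐ/m = log(1 + t), so the limit is
-- S_1(N,k). For the Bell form, B_{n,k}(x) = (n!/k!) [tⁿ] (Σ_j x_j tʲ/j!)ᵏ, which makes it equal
-- to S_{2,μ}(N,k) for every μ; that identity follows by splitting off the first exponent of the
-- Bell sum and applying the binomial theorem to (x_s tˢ/s! + the remaining terms)ᵏ.

open import Defs
open import Data.Bool.Base using (Bool; true; false; if_then_else_; _∧_)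
open import Data.Bool.Properties using (∧-zeroʳ)
open import Data.Empty using (⊥-elim)
import Data.Integer.Base as ℤ
import Data.Integer.Properties as ℤP
open import Data.List.Base using (List; []; _∷_; [_]; map; foldr; concatMap; _++_; upTo)
open import Data.List.Properties using (map-++; map-cong; map-∘; upTo-∷ʳ)
open import Data.Nat.Base as ℕ using (ℕ; zero; suc; _≤_; _<_; _∸_; s≤s; z≤n; _!; _≡ᵇ_; _≤ᵇ_)
import Data.Nat.Properties as ℕP
open import Data.Nat.Properties using (_!≢0; _!*_!≢0)
open import Data.Nat.Combinatorics
  using (_C_; nCk+nC[k+1]≡[n+1]C[k+1]; k>n⇒nCk≡0; nCk≡n!/k![n-k]!; k![n∸k]!∣n!)
open import Data.Nat.DivMod using (m/n*n≡m)
open import Data.Product using (_×_; _,_)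
open import Data.Rational as ℚ using (ℚ; 0ℚ; 1ℚ; _+_; _*_; _-_; -_; 1/_; NonZero; ∣_∣; toℚᵘ)
import Data.Rational.Properties as ℚP
open import Data.Rational.Solver using (module +-*-Solver)
open +-*-Solver using (solve; _:+_; _:*_; :-_; _:=_; con)
import Data.Rational.Unnormalised as ℚᵘ
import Data.Rational.Unnormalised.Properties as ℚᵘP
open import Data.Sum using (inj₁; inj₂)
open import Data.Vec.Base using (Vec; []; _∷_)
open import Function.Base using (_∘_)
open import Relation.Binary.PropositionalEquality
  using (_≡_; _≢_; refl; sym; trans; cong; cong₂; subst; module ≡-Reasoning)
open import Relation.Nullary using (¬_; yes; no)
open import Relation.Nullary.Decidable using (dec-true; dec-false)

ℕ→ℚ-toℚᵘ : ∀ n → toℚᵘ (ℕ→ℚ n) ℚᵘ.≃ ℚᵘ.mkℚᵘ (ℤ.+ n) 0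
ℕ→ℚ-toℚᵘ n = ℚP.toℚᵘ-fromℚᵘ (ℚᵘ.mkℚᵘ (ℤ.+ n) 0)

ℕ→ℚ-+ : ∀ m n → ℕ→ℚ (m ℕ.+ n) ≡ ℕ→ℚ m + ℕ→ℚ n
ℕ→ℚ-+ m n = ℚP.toℚᵘ-injective (begin
  toℚᵘ (ℕ→ℚ (m ℕ.+ n))                         ≈⟨ ℕ→ℚ-toℚᵘ (m ℕ.+ n) ⟩
  ℚᵘ.mkℚᵘ (ℤ.+ (m ℕ.+ n)) 0                     ≈⟨ ℚᵘ.*≡* numerators ⟩
  ℚᵘ.mkℚᵘ (ℤ.+ m) 0 ℚᵘ.+ ℚᵘ.mkℚᵘ (ℤ.+ n) 0      ≈⟨ ℚᵘP.+-cong (ℕ→ℚ-toℚᵘ m) (ℕ→ℚ-toℚᵘ n) ⟨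
  toℚᵘ (ℕ→ℚ m) ℚᵘ.+ toℚᵘ (ℕ→ℚ n)                ≈⟨ ℚP.toℚᵘ-homo-+ (ℕ→ℚ m) (ℕ→ℚ n) ⟨
  toℚᵘ (ℕ→ℚ m + ℕ→ℚ n)                          ∎)
  where
  open ℚᵘP.≃-Reasoning
  numerators : ℤ.+ (m ℕ.+ n) ℤ.* ℤ.1ℤ ≡ (ℤ.+ m ℤ.* ℤ.1ℤ ℤ.+ ℤ.+ n ℤ.* ℤ.1ℤ) ℤ.* ℤ.1ℤ
  numerators = trans (ℤP.*-identityʳ _) (trans (ℤP.pos-+ m n) (sym (trans (ℤP.*-identityʳ _)
                 (cong₂ ℤ._+_ (ℤP.*-identityʳ (ℤ.+ m)) (ℤP.*-identityʳ (ℤ.+ n))))))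

ℕ→ℚ-* : ∀ m n → ℕ→ℚ (m ℕ.* n) ≡ ℕ→ℚ m * ℕ→ℚ n
ℕ→ℚ-* m n = ℚP.toℚᵘ-injective (begin
  toℚᵘ (ℕ→ℚ (m ℕ.* n))                         ≈⟨ ℕ→ℚ-toℚᵘ (m ℕ.* n) ⟩
  ℚᵘ.mkℚᵘ (ℤ.+ (m ℕ.* n)) 0                     ≈⟨ ℚᵘ.*≡* numerators ⟩
  ℚᵘ.mkℚᵘ (ℤ.+ m) 0 ℚᵘ.* ℚᵘ.mkℚᵘ (ℤ.+ n) 0      ≈⟨ ℚᵘP.*-cong (ℕ→ℚ-toℚᵘ m) (ℕ→ℚ-toℚᵘ n) ⟨
  toℚᵘ (ℕ→ℚ m) ℚᵘ.* toℚᵘ (ℕ→ℚ n)                ≈⟨ ℚP.toℚᵘ-homo-* (ℕ→ℚ m) (ℕ→ℚ n) ⟨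
  toℚᵘ (ℕ→ℚ m * ℕ→ℚ n)                          ∎)
  where
  open ℚᵘP.≃-Reasoning
  numerators : ℤ.+ (m ℕ.* n) ℤ.* ℤ.1ℤ ≡ (ℤ.+ m ℤ.* ℤ.+ n) ℤ.* ℤ.1ℤ
  numerators = trans (ℤP.*-identityʳ _) (trans (ℤP.pos-* m n) (sym (ℤP.*-identityʳ _)))

1/ℕ-inverse : ∀ d .{{_ : ℕ.NonZero d}} → ((ℤ.+ 1) ℚ./ d) * ℕ→ℚ d ≡ 1ℚ
1/ℕ-inverse (suc d) = ℚP.toℚᵘ-injective (begin
  toℚᵘ ((ℤ.+ 1) ℚ./ suc d * ℕ→ℚ (suc d))
    ≈⟨ ℚP.toℚᵘ-homo-* ((ℤ.+ 1) ℚ./ suc d) (ℕ→ℚ (suc d)) ⟩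
  toℚᵘ ((ℤ.+ 1) ℚ./ suc d) ℚᵘ.* toℚᵘ (ℕ→ℚ (suc d))
    ≈⟨ ℚᵘP.*-cong (ℚP.toℚᵘ-fromℚᵘ (ℚᵘ.mkℚᵘ (ℤ.+ 1) d)) (ℕ→ℚ-toℚᵘ (suc d)) ⟩
  ℚᵘ.mkℚᵘ (ℤ.+ 1) d ℚᵘ.* ℚᵘ.mkℚᵘ (ℤ.+ suc d) 0
    ≈⟨ ℚᵘ.*≡* (cong (λ m → ℤ.+ suc m) (trans (ℕP.*-identityʳ _)
         (trans (ℕP.+-identityʳ d) (sym (trans (ℕP.+-identityʳ _) (ℕP.*-identityʳ d)))))) ⟩
  ℚᵘ.1ℚᵘ
    ∎)
  where open ℚᵘP.≃-Reasoning

-- Lipschitz continuity at 0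

record LipschitzAt0 (f : ℚ → ℚ) : Set where
  constructor _,_
  field
    constant : ℚ
    bound    : ∀ l → ∣ l ∣ ℚ.≤ 1ℚ → ∣ f l - f 0ℚ ∣ ℚ.≤ constant * ∣ l ∣

open LipschitzAt0

*-mono-≤-nonNeg : ∀ {a b c d} → 0ℚ ℚ.≤ a → 0ℚ ℚ.≤ c → a ℚ.≤ b → c ℚ.≤ d → a * c ℚ.≤ b * d
*-mono-≤-nonNeg {a} {b} {c} {d} 0≤a 0≤c a≤b c≤d = ℚP.≤-trans
  (ℚP.*-monoʳ-≤-nonNeg c {{ℚ.nonNegative 0≤c}} a≤b)
  (ℚP.*-monoˡ-≤-nonNeg b {{ℚ.nonNegative (ℚP.≤-trans 0≤a a≤b)}} c≤d)

constant-nonNeg : ∀ {f} (Lf : LipschitzAt0 f) → 0ℚ ℚ.≤ constant Lf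
constant-nonNeg {f} (c , bd) =
  ℚP.≤-trans (ℚP.0≤∣p∣ (f 1ℚ - f 0ℚ)) (subst (_ ℚ.≤_) (ℚP.*-identityʳ c) (bd 1ℚ ℚP.≤-refl))

bounded : ∀ {f} (Lf : LipschitzAt0 f) l → ∣ l ∣ ℚ.≤ 1ℚ → ∣ f l ∣ ℚ.≤ ∣ f 0ℚ ∣ + constant Lf
bounded {f} Lf@(c , bd) l ∣l∣≤1 = begin
  ∣ f l ∣                      ≡⟨ cong ∣_∣ (solve 2 (λ a b → a := (a :+ :- b) :+ b) refl (f l) (f 0ℚ)) ⟩
  ∣ (f l - f 0ℚ) + f 0ℚ ∣      ≤⟨ ℚP.∣p+q∣≤∣p∣+∣q∣ (f l - f 0ℚ) (f 0ℚ) ⟩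
  ∣ f l - f 0ℚ ∣ + ∣ f 0ℚ ∣    ≤⟨ ℚP.+-monoˡ-≤ ∣ f 0ℚ ∣ (bd l ∣l∣≤1) ⟩
  c * ∣ l ∣ + ∣ f 0ℚ ∣         ≤⟨ ℚP.+-monoˡ-≤ ∣ f 0ℚ ∣ c∣l∣≤c ⟩
  c * 1ℚ + ∣ f 0ℚ ∣            ≡⟨ solve 2 (λ c a → c :* con 1ℚ :+ a := a :+ c) refl c ∣ f 0ℚ ∣ ⟩
  ∣ f 0ℚ ∣ + c                 ∎
  where
  open ℚP.≤-Reasoning
  c∣l∣≤c : c * ∣ l ∣ ℚ.≤ c * 1ℚ
  c∣l∣≤c = ℚP.*-monoˡ-≤-nonNeg c {{ℚ.nonNegative (constant-nonNeg Lf)}} ∣l∣≤1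

lipschitz-const : ∀ a → LipschitzAt0 (λ _ → a)
lipschitz-const a = 0ℚ , λ l _ →
  ℚP.≤-reflexive (trans (cong ∣_∣ (ℚP.+-inverseʳ a)) (sym (ℚP.*-zeroˡ ∣ l ∣)))

lipschitz-id : LipschitzAt0 (λ l → l)
lipschitz-id = 1ℚ , λ l _ →
  ℚP.≤-reflexive (trans (cong ∣_∣ (ℚP.+-identityʳ l)) (sym (ℚP.*-identityˡ ∣ l ∣)))

lipschitz-+ : ∀ {f g} → LipschitzAt0 f → LipschitzAt0 g → LipschitzAt0 (λ l → f l + g l)
lipschitz-+ {f} {g} (cf , bf) (cg , bg) = cf + cg , λ l ∣l∣≤1 → begin
  ∣ (f l + g l) - (f 0ℚ + g 0ℚ) ∣
    ≡⟨ cong ∣_∣ (solve 4 (λ a b c d → (a :+ c) :+ :- (b :+ d) := (a :+ :- b) :+ (c :+ :- d))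
                         refl (f l) (f 0ℚ) (g l) (g 0ℚ)) ⟩
  ∣ (f l - f 0ℚ) + (g l - g 0ℚ) ∣
    ≤⟨ ℚP.∣p+q∣≤∣p∣+∣q∣ (f l - f 0ℚ) (g l - g 0ℚ) ⟩
  ∣ f l - f 0ℚ ∣ + ∣ g l - g 0ℚ ∣
    ≤⟨ ℚP.+-mono-≤ (bf l ∣l∣≤1) (bg l ∣l∣≤1) ⟩
  cf * ∣ l ∣ + cg * ∣ l ∣
    ≡⟨ ℚP.*-distribʳ-+ ∣ l ∣ cf cg ⟨
  (cf + cg) * ∣ l ∣
    ∎
  where open ℚP.≤-Reasoning

lipschitz-* : ∀ {f g} → LipschitzAt0 f → LipschitzAt0 g → LipschitzAt0 (λ l → f l * g l)
lipschitz-* {f} {g} (cf , bf) Lg@(cg , bg) = cf * B + a * cg , estimate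
  where
  a = ∣ f 0ℚ ∣
  B = ∣ g 0ℚ ∣ + cg
  estimate : ∀ l → ∣ l ∣ ℚ.≤ 1ℚ → ∣ f l * g l - f 0ℚ * g 0ℚ ∣ ℚ.≤ (cf * B + a * cg) * ∣ l ∣
  estimate l ∣l∣≤1 = begin
    ∣ f l * g l - f 0ℚ * g 0ℚ ∣
      ≡⟨ cong ∣_∣ (solve 4 (λ a b c d → a :* c :+ :- (b :* d) := (a :+ :- b) :* c :+ b :* (c :+ :- d))
                           refl (f l) (f 0ℚ) (g l) (g 0ℚ)) ⟩
    ∣ (f l - f 0ℚ) * g l + f 0ℚ * (g l - g 0ℚ) ∣
      ≤⟨ ℚP.∣p+q∣≤∣p∣+∣q∣ ((f l - f 0ℚ) * g l) (f 0ℚ * (g l - g 0ℚ)) ⟩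
    (∣ (f l - f 0ℚ) * g l ∣) + (∣ f 0ℚ * (g l - g 0ℚ) ∣)
      ≡⟨ cong₂ _+_ (ℚP.∣p*q∣≡∣p∣*∣q∣ (f l - f 0ℚ) (g l)) (ℚP.∣p*q∣≡∣p∣*∣q∣ (f 0ℚ) (g l - g 0ℚ)) ⟩
    (∣ f l - f 0ℚ ∣) * (∣ g l ∣) + a * (∣ g l - g 0ℚ ∣)
      ≤⟨ ℚP.+-mono-≤ (*-mono-≤-nonNeg (ℚP.0≤∣p∣ _) (ℚP.0≤∣p∣ _) (bf l ∣l∣≤1) (bounded Lg l ∣l∣≤1))
                     (ℚP.*-monoˡ-≤-nonNeg a {{ℚP.∣-∣-nonNeg (f 0ℚ)}} (bg l ∣l∣≤1)) ⟩
    cf * (∣ l ∣) * B + a * (cg * (∣ l ∣))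
      ≡⟨ solve 5 (λ c b a d l → c :* l :* b :+ a :* (d :* l) := (c :* b :+ a :* d) :* l)
                 refl cf B a cg (∣ l ∣) ⟩
    (cf * B + a * cg) * (∣ l ∣)
      ∎
    where open ℚP.≤-Reasoning

lipschitz-Σ< : ∀ {F : ℚ → ℕ → ℚ} → (∀ i → LipschitzAt0 (λ l → F l i)) →
               ∀ n → LipschitzAt0 (λ l → Σ< n (F l))
lipschitz-Σ< LF zero = lipschitz-const 0ℚ
lipschitz-Σ< LF (suc n) = lipschitz-+ (lipschitz-Σ< LF n) (LF n)

lipschitz-spow : ∀ {E : ℚ → Series} → (∀ n → LipschitzAt0 (λ l → E l n)) →
                 ∀ k n → LipschitzAt0 (λ l → spow (E l) k n)
lipschitz-spow LE zero zero = lipschitz-const 1ℚ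
lipschitz-spow LE zero (suc n) = lipschitz-const 0ℚ
lipschitz-spow LE (suc k) n =
  lipschitz-Σ< (λ i → lipschitz-* (LE i) (lipschitz-spow LE k (n ∸ i))) (suc n)

lipschitzAt0⇒LimAt0 : ∀ {F : (l : ℚ) → .{{NonZero l}} → ℚ} {g : ℚ → ℚ} {L} →
                      LipschitzAt0 g → g 0ℚ ≡ L → (∀ (l : ℚ) .{{_ : NonZero l}} → F l ≡ g l) →
                      LimAt0 F L
lipschitzAt0⇒LimAt0 {F} {g} {L} Lg@(c , bd) g0≡L F≡g ε ε>0 = δ , δ>0 , close
  where
  K = 1ℚ + c
  instance
    K-pos : ℚ.Positive K
    K-pos = ℚP.pos+nonNeg⇒pos 1ℚ c {{ℚ.nonNegative (constant-nonNeg Lg)}}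
    K-nonZero : NonZero K
    K-nonZero = ℚP.pos⇒nonZero K
    ε-pos : ℚ.Positive ε
    ε-pos = ℚ.positive ε>0
  c≤K : c ℚ.≤ K
  c≤K = subst (ℚ._≤ K) (ℚP.+-identityˡ c) (ℚP.+-monoˡ-≤ c (ℚP.nonNegative⁻¹ 1ℚ))
  δ = (ε * 1/ K) ℚ.⊓ 1ℚ
  δ>0 : 0ℚ ℚ.< δ
  δ>0 with ℚP.⊓-sel (ε * 1/ K) 1ℚ
  ... | inj₁ δ≡ε/K = subst (0ℚ ℚ.<_) (sym δ≡ε/K)
                       (ℚP.positive⁻¹ (ε * 1/ K) {{ℚP.pos*pos⇒pos ε (1/ K) {{ℚP.1/pos⇒pos K}}}})
  ... | inj₂ δ≡1 = subst (0ℚ ℚ.<_) (sym δ≡1) (ℚP.positive⁻¹ 1ℚ)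
  close : ∀ (l : ℚ) .{{_ : NonZero l}} → ∣ l ∣ ℚ.< δ → ∣ F l - L ∣ ℚ.< ε
  close l ∣l∣<δ = begin-strict
    ∣ F l - L ∣          ≡⟨ cong₂ (λ a b → ∣ a - b ∣) (F≡g l) (sym g0≡L) ⟩
    ∣ g l - g 0ℚ ∣       ≤⟨ bd l (ℚP.<⇒≤ (ℚP.<-≤-trans ∣l∣<δ (ℚP.p⊓q≤q (ε * 1/ K) 1ℚ))) ⟩
    c * ∣ l ∣            ≤⟨ ℚP.*-monoʳ-≤-nonNeg ∣ l ∣ {{ℚP.∣-∣-nonNeg l}} c≤K ⟩
    K * ∣ l ∣            <⟨ ℚP.*-monoʳ-<-pos K ∣l∣<δ ⟩
    K * δ                ≤⟨ ℚP.*-monoˡ-≤-nonNeg K {{ℚP.pos⇒nonNeg K}} (ℚP.p⊓q≤p (ε * 1/ K) 1ℚ) ⟩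
    K * (ε * 1/ K)       ≡⟨ solve 3 (λ k e i → k :* (e :* i) := e :* (k :* i)) refl K ε (1/ K) ⟩
    ε * (K * 1/ K)       ≡⟨ cong (ε *_) (ℚP.*-inverseʳ K) ⟩
    ε * 1ℚ               ≡⟨ ℚP.*-identityʳ ε ⟩
    ε                    ∎
    where open ℚP.≤-Reasoning

open ≡-Reasoning

inverse-unique : ∀ {x y d : ℚ} → x * d ≡ 1ℚ → y * d ≡ 1ℚ → x ≡ y
inverse-unique {x} {y} {d} xd≡1 yd≡1 = begin
  x             ≡⟨ ℚP.*-identityʳ x ⟨
  x * 1ℚ        ≡⟨ cong (x *_) yd≡1 ⟨
  x * (y * d)   ≡⟨ solve 3 (λ x y d → x :* (y :* d) := (x :* d) :* y) refl x y d ⟩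
  (x * d) * y   ≡⟨ cong (_* y) xd≡1 ⟩
  1ℚ * y        ≡⟨ ℚP.*-identityˡ y ⟩
  y             ∎

inv!-inverse : ∀ n → inv! n * ℕ→ℚ (n !) ≡ 1ℚ
inv!-inverse n = 1/ℕ-inverse (n !) {{n !≢0}}

inv!-suc : ∀ m → ℕ→ℚ (m !) * inv! (suc m) ≡ (ℤ.+ 1) ℚ./ suc m
inv!-suc m = inverse-unique (begin
  ℕ→ℚ (m !) * inv! (suc m) * ℕ→ℚ (suc m)
    ≡⟨ solve 3 (λ a b c → a :* b :* c := b :* (c :* a)) refl (ℕ→ℚ (m !)) (inv! (suc m)) (ℕ→ℚ (suc m)) ⟩
  inv! (suc m) * (ℕ→ℚ (suc m) * ℕ→ℚ (m !))
    ≡⟨ cong (inv! (suc m) *_) (ℕ→ℚ-* (suc m) (m !)) ⟨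
  inv! (suc m) * ℕ→ℚ (suc m !)
    ≡⟨ inv!-inverse (suc m) ⟩
  1ℚ
    ∎) (1/ℕ-inverse (suc m))

inv!-C : ∀ {k i} → i ≤ k → inv! k * ℕ→ℚ (k C i) ≡ inv! i * inv! (k ∸ i)
inv!-C {k} {i} i≤k = inverse-unique {d = ℕ→ℚ (i! ℕ.* [k∸i]!)} (begin
    inv! k * ℕ→ℚ (k C i) * ℕ→ℚ (i! ℕ.* [k∸i]!)     ≡⟨ ℚP.*-assoc (inv! k) _ _ ⟩
    inv! k * (ℕ→ℚ (k C i) * ℕ→ℚ (i! ℕ.* [k∸i]!))   ≡⟨ cong (inv! k *_) (ℕ→ℚ-* (k C i) _) ⟨
    inv! k * ℕ→ℚ ((k C i) ℕ.* (i! ℕ.* [k∸i]!))     ≡⟨ cong (λ z → inv! k * ℕ→ℚ z) C*i!*[k∸i]!≡k! ⟩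
    inv! k * ℕ→ℚ (k !)                              ≡⟨ inv!-inverse k ⟩
    1ℚ                                              ∎)
  (begin
    inv! i * inv! (k ∸ i) * ℕ→ℚ (i! ℕ.* [k∸i]!)
      ≡⟨ cong (inv! i * inv! (k ∸ i) *_) (ℕ→ℚ-* i! [k∸i]!) ⟩
    inv! i * inv! (k ∸ i) * (ℕ→ℚ i! * ℕ→ℚ [k∸i]!)
      ≡⟨ solve 4 (λ a b c d → a :* b :* (c :* d) := (a :* c) :* (b :* d)) refl
                 (inv! i) (inv! (k ∸ i)) (ℕ→ℚ i!) (ℕ→ℚ [k∸i]!) ⟩
    (inv! i * ℕ→ℚ i!) * (inv! (k ∸ i) * ℕ→ℚ [k∸i]!)
      ≡⟨ cong₂ _*_ (inv!-inverse i) (inv!-inverse (k ∸ i)) ⟩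
    1ℚ
      ∎)
  where
  i! = i !
  [k∸i]! = (k ∸ i) !
  C*i!*[k∸i]!≡k! : (k C i) ℕ.* (i! ℕ.* [k∸i]!) ≡ k !
  C*i!*[k∸i]!≡k! = trans (cong (ℕ._* (i! ℕ.* [k∸i]!)) (nCk≡n!/k![n-k]! i≤k))
                         (m/n*n≡m {{i !* (k ∸ i) !≢0}} (k![n∸k]!∣n! i≤k))

^-+ : ∀ (x : ℚ) m n → x ^ (m ℕ.+ n) ≡ x ^ m * x ^ n
^-+ x zero n = sym (ℚP.*-identityˡ _)
^-+ x (suc m) n = trans (cong (x *_) (^-+ x m n)) (sym (ℚP.*-assoc x _ _))

^-distribʳ-* : ∀ (x y : ℚ) n → (x * y) ^ n ≡ x ^ n * y ^ n
^-distribʳ-* x y zero = refl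
^-distribʳ-* x y (suc n) = trans (cong ((x * y) *_) (^-distribʳ-* x y n))
  (solve 4 (λ x y a b → (x :* y) :* (a :* b) := (x :* a) :* (y :* b)) refl x y (x ^ n) (y ^ n))

1^n≡1 : ∀ n → 1ℚ ^ n ≡ 1ℚ
1^n≡1 zero = refl
1^n≡1 (suc n) = trans (ℚP.*-identityˡ _) (1^n≡1 n)

^-cancelˡ : ∀ (l : ℚ) .{{_ : NonZero l}} n {x y} → l ^ n * x ≡ l ^ n * y → x ≡ y
^-cancelˡ l n {x} {y} eq = begin
  x                          ≡⟨ ℚP.*-identityˡ x ⟨
  1ℚ * x                     ≡⟨ cong (_* x) l⁻ⁿlⁿ≡1 ⟨
  ((1/ l) ^ n * l ^ n) * x   ≡⟨ ℚP.*-assoc ((1/ l) ^ n) (l ^ n) x ⟩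
  (1/ l) ^ n * (l ^ n * x)   ≡⟨ cong ((1/ l) ^ n *_) eq ⟩
  (1/ l) ^ n * (l ^ n * y)   ≡⟨ ℚP.*-assoc ((1/ l) ^ n) (l ^ n) y ⟨
  ((1/ l) ^ n * l ^ n) * y   ≡⟨ cong (_* y) l⁻ⁿlⁿ≡1 ⟩
  1ℚ * y                     ≡⟨ ℚP.*-identityˡ y ⟩
  y                          ∎
  where
  l⁻ⁿlⁿ≡1 : (1/ l) ^ n * l ^ n ≡ 1ℚ
  l⁻ⁿlⁿ≡1 = trans (sym (^-distribʳ-* (1/ l) l n)) (trans (cong (_^ n) (ℚP.*-inverseˡ l)) (1^n≡1 n))

Σ<-cong : ∀ n {f g : ℕ → ℚ} → (∀ i → i < n → f i ≡ g i) → Σ< n f ≡ Σ< n g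
Σ<-cong zero f≡g = refl
Σ<-cong (suc n) f≡g = cong₂ _+_ (Σ<-cong n (λ i i<n → f≡g i (ℕP.m<n⇒m<1+n i<n))) (f≡g n ℕP.≤-refl)

Σ<-cong′ : ∀ n {f g : ℕ → ℚ} → (∀ i → f i ≡ g i) → Σ< n f ≡ Σ< n g
Σ<-cong′ n f≡g = Σ<-cong n (λ i _ → f≡g i)

Σ<-zero : ∀ n → Σ< n (λ _ → 0ℚ) ≡ 0ℚ
Σ<-zero zero = refl
Σ<-zero (suc n) = cong (_+ 0ℚ) (Σ<-zero n)

Σ<-distrib-+ : ∀ n (f g : ℕ → ℚ) → Σ< n (λ i → f i + g i) ≡ Σ< n f + Σ< n g
Σ<-distrib-+ zero f g = refl
Σ<-distrib-+ (suc n) f g = begin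
  Σ< n (λ i → f i + g i) + (f n + g n)
    ≡⟨ cong (_+ (f n + g n)) (Σ<-distrib-+ n f g) ⟩
  (Σ< n f + Σ< n g) + (f n + g n)
    ≡⟨ solve 4 (λ a b c d → (a :+ b) :+ (c :+ d) := (a :+ c) :+ (b :+ d)) refl (Σ< n f) (Σ< n g) (f n) (g n) ⟩
  (Σ< n f + f n) + (Σ< n g + g n)
    ∎

*-distribˡ-Σ< : ∀ n c (f : ℕ → ℚ) → c * Σ< n f ≡ Σ< n (λ i → c * f i)
*-distribˡ-Σ< zero c f = ℚP.*-zeroʳ c
*-distribˡ-Σ< (suc n) c f =
  trans (ℚP.*-distribˡ-+ c (Σ< n f) (f n)) (cong (_+ c * f n) (*-distribˡ-Σ< n c f))

Σ<-suc : ∀ n (f : ℕ → ℚ) → Σ< (suc n) f ≡ f 0 + Σ< n (λ i → f (suc i))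
Σ<-suc zero f = trans (ℚP.+-identityˡ (f 0)) (sym (ℚP.+-identityʳ (f 0)))
Σ<-suc (suc n) f = trans (cong (_+ f (suc n)) (Σ<-suc n f)) (ℚP.+-assoc (f 0) _ _)

Σ<-comm : ∀ m n (F : ℕ → ℕ → ℚ) → Σ< m (λ i → Σ< n (F i)) ≡ Σ< n (λ j → Σ< m (λ i → F i j))
Σ<-comm zero n F = sym (Σ<-zero n)
Σ<-comm (suc m) n F = trans (cong (_+ Σ< n (F m)) (Σ<-comm m n F)) (sym (Σ<-distrib-+ n _ (F m)))

Σ<-vanishing-tail : ∀ m d (f : ℕ → ℚ) → (∀ i → m ≤ i → i < m ℕ.+ d → f i ≡ 0ℚ) →
                    Σ< (m ℕ.+ d) f ≡ Σ< m f
Σ<-vanishing-tail m zero f _ = cong (λ n → Σ< n f) (ℕP.+-identityʳ m)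
Σ<-vanishing-tail m (suc d) f tail≡0 = begin
  Σ< (m ℕ.+ suc d) f             ≡⟨ cong (λ n → Σ< n f) (ℕP.+-suc m d) ⟩
  Σ< (m ℕ.+ d) f + f (m ℕ.+ d)   ≡⟨ cong₂ _+_ (Σ<-vanishing-tail m d f shorter-tail≡0) last≡0 ⟩
  Σ< m f + 0ℚ                    ≡⟨ ℚP.+-identityʳ _ ⟩
  Σ< m f                         ∎
  where
  shorter-tail≡0 : ∀ i → m ≤ i → i < m ℕ.+ d → f i ≡ 0ℚ
  shorter-tail≡0 i m≤i i<m+d = tail≡0 i m≤i (ℕP.<-≤-trans i<m+d (ℕP.+-monoʳ-≤ m (ℕP.n≤1+n d)))
  last≡0 : f (m ℕ.+ d) ≡ 0ℚ
  last≡0 = tail≡0 (m ℕ.+ d) (ℕP.m≤m+n m d) (ℕP.+-monoʳ-< m ℕP.≤-refl)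

sumℚ : List ℚ → ℚ
sumℚ = foldr _+_ 0ℚ

sumℚ-++ : ∀ xs ys → sumℚ (xs ++ ys) ≡ sumℚ xs + sumℚ ys
sumℚ-++ [] ys = sym (ℚP.+-identityˡ _)
sumℚ-++ (x ∷ xs) ys = trans (cong (x +_) (sumℚ-++ xs ys)) (sym (ℚP.+-assoc x _ _))

sumℚ-concatMap : ∀ {A B : Set} (f : B → ℚ) (g : A → List B) xs →
                 sumℚ (map f (concatMap g xs)) ≡ sumℚ (map (λ x → sumℚ (map f (g x))) xs)
sumℚ-concatMap f g [] = refl
sumℚ-concatMap f g (x ∷ xs) = begin
  sumℚ (map f (g x ++ concatMap g xs))
    ≡⟨ cong sumℚ (map-++ f (g x) (concatMap g xs)) ⟩
  sumℚ (map f (g x) ++ map f (concatMap g xs))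
    ≡⟨ sumℚ-++ (map f (g x)) _ ⟩
  sumℚ (map f (g x)) + sumℚ (map f (concatMap g xs))
    ≡⟨ cong (sumℚ (map f (g x)) +_) (sumℚ-concatMap f g xs) ⟩
  sumℚ (map f (g x)) + sumℚ (map (λ x → sumℚ (map f (g x))) xs)
    ∎

*-distribˡ-sumℚ : ∀ {A : Set} c (f : A → ℚ) xs → c * sumℚ (map f xs) ≡ sumℚ (map (λ x → c * f x) xs)
*-distribˡ-sumℚ c f [] = ℚP.*-zeroʳ c
*-distribˡ-sumℚ c f (x ∷ xs) =
  trans (ℚP.*-distribˡ-+ c (f x) _) (cong (c * f x +_) (*-distribˡ-sumℚ c f xs))

sumℚ-vanishing : ∀ {A : Set} (f : A → ℚ) xs → (∀ x → f x ≡ 0ℚ) → sumℚ (map f xs) ≡ 0ℚ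
sumℚ-vanishing f [] _ = refl
sumℚ-vanishing f (x ∷ xs) f≡0 = trans (cong₂ _+_ (f≡0 x) (sumℚ-vanishing f xs f≡0)) (ℚP.+-identityˡ 0ℚ)

sumℚ-upTo : ∀ n (f : ℕ → ℚ) → sumℚ (map f (upTo n)) ≡ Σ< n f
sumℚ-upTo zero f = refl
sumℚ-upTo (suc n) f = begin
  sumℚ (map f (upTo (suc n)))            ≡⟨ cong (sumℚ ∘ map f) (upTo-∷ʳ n) ⟨
  sumℚ (map f (upTo n ++ [ n ]))         ≡⟨ cong sumℚ (map-++ f (upTo n) [ n ]) ⟩
  sumℚ (map f (upTo n) ++ [ f n ])       ≡⟨ sumℚ-++ (map f (upTo n)) [ f n ] ⟩
  sumℚ (map f (upTo n)) + (f n + 0ℚ)     ≡⟨ cong₂ _+_ (sumℚ-upTo n f) (ℚP.+-identityʳ (f n)) ⟩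
  Σ< n f + f n                           ∎

-- Formal power series

spow-cong : ∀ {f g : Series} → (∀ n → f n ≡ g n) → ∀ k n → spow f k n ≡ spow g k n
spow-cong f≗g zero zero = refl
spow-cong f≗g zero (suc n) = refl
spow-cong f≗g (suc k) n = Σ<-cong′ (suc n) (λ i → cong₂ _*_ (f≗g i) (spow-cong f≗g k (n ∸ i)))

spow-0-indep : ∀ f g n → spow f 0 n ≡ spow g 0 n
spow-0-indep f g zero = refl
spow-0-indep f g (suc n) = refl

spow-zero-series : ∀ k n → spow (λ _ → 0ℚ) (suc k) n ≡ 0ℚ
spow-zero-series k n = trans (Σ<-cong′ (suc n) (λ j → ℚP.*-zeroˡ (spow (λ _ → 0ℚ) k (n ∸ j)))) (Σ<-zero (suc n))

spow-below-order : ∀ (f : Series) → f 0 ≡ 0ℚ → ∀ k n → n < k → spow f k n ≡ 0ℚ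
spow-below-order f f0≡0 (suc k) n n<1+k = trans (Σ<-cong (suc n) term≡0) (Σ<-zero (suc n))
  where
  term≡0 : ∀ i → i < suc n → f i * spow f k (n ∸ i) ≡ 0ℚ
  term≡0 zero _ = trans (cong (_* spow f k n) f0≡0) (ℚP.*-zeroˡ (spow f k n))
  term≡0 (suc i) (s≤s i<n) =
    trans (cong (f (suc i) *_) (spow-below-order f f0≡0 k (n ∸ suc i) n∸1+i<k)) (ℚP.*-zeroʳ (f (suc i)))
    where
    n∸1+i<k : n ∸ suc i < k
    n∸1+i<k = ℕP.<-≤-trans (ℕP.∸-monoʳ-< {n} {suc i} {0} (s≤s z≤n) i<n) (ℕP.≤-pred n<1+k)

m≤n⇒n<m+o⇒n∸m<o : ∀ {m n o} → m ≤ n → n < m ℕ.+ o → n ∸ m < o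
m≤n⇒n<m+o⇒n∸m<o {m} {n} {o} m≤n n<m+o =
  ℕP.+-cancelˡ-< m (n ∸ m) o (subst (_< m ℕ.+ o) (sym (ℕP.m+[n∸m]≡n m≤n)) n<m+o)

spow-agree : ∀ (f g : Series) M → f 0 ≡ 0ℚ → g 0 ≡ 0ℚ → (∀ j → j ≤ M → f j ≡ g j) →
             ∀ k n → n < M ℕ.+ k → spow f k n ≡ spow g k n
spow-agree f g M f0≡0 g0≡0 f≡g zero zero _ = refl
spow-agree f g M f0≡0 g0≡0 f≡g zero (suc n) _ = refl
spow-agree f g M f0≡0 g0≡0 f≡g (suc k) n n<M+1+k = Σ<-cong (suc n) term
  where
  term : ∀ i → i < suc n → f i * spow f k (n ∸ i) ≡ g i * spow g k (n ∸ i)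
  term zero _ = begin
    f 0 * spow f k n   ≡⟨ cong (_* spow f k n) f0≡0 ⟩
    0ℚ * spow f k n    ≡⟨ ℚP.*-zeroˡ (spow f k n) ⟩
    0ℚ                 ≡⟨ ℚP.*-zeroˡ (spow g k n) ⟨
    0ℚ * spow g k n    ≡⟨ cong (_* spow g k n) g0≡0 ⟨
    g 0 * spow g k n   ∎
  term (suc i) (s≤s i<n) with suc i ℕP.≤? M
  ... | yes i<M = cong₂ _*_ (f≡g (suc i) i<M) (spow-agree f g M f0≡0 g0≡0 f≡g k (n ∸ suc i) n∸1+i<M+k)
    where
    n∸1+i<M+k : n ∸ suc i < M ℕ.+ k
    n∸1+i<M+k = ℕP.<-≤-trans (ℕP.∸-monoʳ-< {n} {suc i} {0} (s≤s z≤n) i<n)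
                             (ℕP.≤-pred (subst (n <_) (ℕP.+-suc M k) n<M+1+k))
  ... | no i≮M = begin
    f (suc i) * spow f k (n ∸ suc i)   ≡⟨ cong (f (suc i) *_) (spow-below-order f f0≡0 k (n ∸ suc i) n∸1+i<k) ⟩
    f (suc i) * 0ℚ                     ≡⟨ ℚP.*-zeroʳ (f (suc i)) ⟩
    0ℚ                                 ≡⟨ ℚP.*-zeroʳ (g (suc i)) ⟨
    g (suc i) * 0ℚ                     ≡⟨ cong (g (suc i) *_) (spow-below-order g g0≡0 k (n ∸ suc i) n∸1+i<k) ⟨
    g (suc i) * spow g k (n ∸ suc i)   ∎
    where
    n<1+i+k : n < suc i ℕ.+ k
    n<1+i+k = ℕP.<-≤-trans n<M+1+k
      (subst (_≤ suc i ℕ.+ k) (sym (ℕP.+-suc M k)) (s≤s (ℕP.+-monoˡ-≤ k (ℕP.≤-pred (ℕP.≰⇒> i≮M)))))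
    n∸1+i<k : n ∸ suc i < k
    n∸1+i<k = m≤n⇒n<m+o⇒n∸m<o i<n n<1+i+k

-- monomial a s = a tˢ  and  shift d h = tᵈ h.
monomial : ℚ → ℕ → Series
monomial a s j = if j ≡ᵇ s then a else 0ℚ

shift : ℕ → Series → Series
shift d h n = if d ≤ᵇ n then h (n ∸ d) else 0ℚ

monomial-≡ : ∀ a s → monomial a s s ≡ a
monomial-≡ a s = cong (λ b → if b then a else 0ℚ) (dec-true (s ℕP.≟ s) refl)

monomial-≢ : ∀ a {s j} → j ≢ s → monomial a s j ≡ 0ℚ
monomial-≢ a {s} {j} j≢s = cong (λ b → if b then a else 0ℚ) (dec-false (j ℕP.≟ s) j≢s)

shift-≥ : ∀ d h {n} → d ≤ n → shift d h n ≡ h (n ∸ d)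
shift-≥ d h {n} d≤n = cong (λ b → if b then h (n ∸ d) else 0ℚ) (dec-true (d ℕP.≤? n) d≤n)

shift-< : ∀ d h {n} → n < d → shift d h n ≡ 0ℚ
shift-< d h {n} n<d = cong (λ b → if b then h (n ∸ d) else 0ℚ) (dec-false (d ℕP.≤? n) (ℕP.<⇒≱ n<d))

shift-cong : ∀ d {h h′ : Series} → (∀ m → h m ≡ h′ m) → ∀ n → shift d h n ≡ shift d h′ n
shift-cong d h≗h′ n with d ≤ᵇ n
... | true = h≗h′ (n ∸ d)
... | false = refl

shift-scale : ∀ d c h n → shift d (λ m → c * h m) n ≡ c * shift d h n
shift-scale d c h n with d ≤ᵇ n
... | true = refl
... | false = sym (ℚP.*-zeroʳ c)

shift-Σ< : ∀ d r (H : ℕ → Series) n → shift d (λ m → Σ< r (λ i → H i m)) n ≡ Σ< r (λ i → shift d (H i) n)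
shift-Σ< d r H n with d ≤ᵇ n
... | true = refl
... | false = sym (Σ<-zero r)

shift-shift : ∀ s d h n → shift s (shift d h) n ≡ shift (s ℕ.+ d) h n
shift-shift s d h n with s ℕP.≤? n
... | no s≰n = trans (shift-< s (shift d h) (ℕP.≰⇒> s≰n))
                     (sym (shift-< (s ℕ.+ d) h (ℕP.<-≤-trans (ℕP.≰⇒> s≰n) (ℕP.m≤m+n s d))))
... | yes s≤n with d ℕP.≤? n ∸ s
...   | yes d≤n∸s = begin
  shift s (shift d h) n   ≡⟨ shift-≥ s (shift d h) s≤n ⟩
  shift d h (n ∸ s)       ≡⟨ shift-≥ d h d≤n∸s ⟩
  h (n ∸ s ∸ d)           ≡⟨ cong h (ℕP.∸-+-assoc n s d) ⟩
  h (n ∸ (s ℕ.+ d))       ≡⟨ shift-≥ (s ℕ.+ d) h s+d≤n ⟨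
  shift (s ℕ.+ d) h n     ∎
  where
  s+d≤n : s ℕ.+ d ≤ n
  s+d≤n = subst (s ℕ.+ d ≤_) (ℕP.m+[n∸m]≡n s≤n) (ℕP.+-monoʳ-≤ s d≤n∸s)
...   | no d≰n∸s = trans (shift-≥ s (shift d h) s≤n)
                     (trans (shift-< d h (ℕP.≰⇒> d≰n∸s)) (sym (shift-< (s ℕ.+ d) h (ℕP.≰⇒> s+d≰n))))
  where
  s+d≰n : ¬ s ℕ.+ d ≤ n
  s+d≰n s+d≤n = d≰n∸s (subst (_≤ n ∸ s) (ℕP.m+n∸m≡n s d) (ℕP.∸-monoˡ-≤ s s+d≤n))

Σ<-monomial-≤ : ∀ a s (H : ℕ → ℚ) m → m ≤ s → Σ< m (λ j → monomial a s j * H j) ≡ 0ℚ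
Σ<-monomial-≤ a s H zero _ = refl
Σ<-monomial-≤ a s H (suc m) m<s = begin
  Σ< m (λ j → monomial a s j * H j) + monomial a s m * H m
    ≡⟨ cong₂ _+_ (Σ<-monomial-≤ a s H m (ℕP.<⇒≤ m<s)) (cong (_* H m) (monomial-≢ a (ℕP.<⇒≢ m<s))) ⟩
  0ℚ + 0ℚ * H m
    ≡⟨ cong (0ℚ +_) (ℚP.*-zeroˡ (H m)) ⟩
  0ℚ
    ∎

Σ<-monomial-> : ∀ a s (H : ℕ → ℚ) m → s < m → Σ< m (λ j → monomial a s j * H j) ≡ a * H s
Σ<-monomial-> a s H (suc m) (s≤s s≤m) with ℕP.m≤n⇒m<n∨m≡n s≤m
... | inj₁ s<m = begin
  Σ< m (λ j → monomial a s j * H j) + monomial a s m * H m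
    ≡⟨ cong₂ _+_ (Σ<-monomial-> a s H m s<m) (cong (_* H m) (monomial-≢ a (ℕP.>⇒≢ s<m))) ⟩
  a * H s + 0ℚ * H m
    ≡⟨ cong (a * H s +_) (ℚP.*-zeroˡ (H m)) ⟩
  a * H s + 0ℚ
    ≡⟨ ℚP.+-identityʳ (a * H s) ⟩
  a * H s
    ∎
... | inj₂ refl = begin
  Σ< s (λ j → monomial a s j * H j) + monomial a s s * H s
    ≡⟨ cong₂ _+_ (Σ<-monomial-≤ a s H s ℕP.≤-refl) (cong (_* H s) (monomial-≡ a s)) ⟩
  0ℚ + a * H s
    ≡⟨ ℚP.+-identityˡ (a * H s) ⟩
  a * H s
    ∎

monomial-⊛ : ∀ a s h n → (monomial a s ⊛ h) n ≡ a * shift s h n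
monomial-⊛ a s h n with s ℕP.≤? n
... | yes s≤n = trans (Σ<-monomial-> a s (λ j → h (n ∸ j)) (suc n) (s≤s s≤n))
                      (cong (a *_) (sym (shift-≥ s h s≤n)))
... | no s≰n = trans (Σ<-monomial-≤ a s (λ j → h (n ∸ j)) (suc n) (ℕP.≰⇒> s≰n))
                     (sym (trans (cong (a *_) (shift-< s h (ℕP.≰⇒> s≰n))) (ℚP.*-zeroʳ a)))

⊛-shift : ∀ g d h n → (g ⊛ shift d h) n ≡ shift d (g ⊛ h) n
⊛-shift g d h n with d ℕP.≤? n
... | no d≰n = begin
  (g ⊛ shift d h) n      ≡⟨ Σ<-cong′ (suc n) term≡0 ⟩
  Σ< (suc n) (λ _ → 0ℚ)  ≡⟨ Σ<-zero (suc n) ⟩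
  0ℚ                     ≡⟨ shift-< d (g ⊛ h) n<d ⟨
  shift d (g ⊛ h) n      ∎
  where
  n<d : n < d
  n<d = ℕP.≰⇒> d≰n
  term≡0 : ∀ j → g j * shift d h (n ∸ j) ≡ 0ℚ
  term≡0 j = trans (cong (g j *_) (shift-< d h (ℕP.≤-<-trans (ℕP.m∸n≤m n j) n<d))) (ℚP.*-zeroʳ (g j))
... | yes d≤n = begin
  Σ< (suc n) term            ≡⟨ cong (λ m → Σ< (suc m) term) e+d≡n ⟨
  Σ< (suc e ℕ.+ d) term      ≡⟨ Σ<-vanishing-tail (suc e) d term beyond ⟩
  Σ< (suc e) term            ≡⟨ Σ<-cong (suc e) within ⟩
  (g ⊛ h) e                  ≡⟨ shift-≥ d (g ⊛ h) d≤n ⟨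
  shift d (g ⊛ h) n          ∎
  where
  e = n ∸ d
  term : ℕ → ℚ
  term j = g j * shift d h (n ∸ j)
  e+d≡n : e ℕ.+ d ≡ n
  e+d≡n = ℕP.m∸n+n≡m d≤n
  beyond : ∀ j → suc e ≤ j → j < suc e ℕ.+ d → term j ≡ 0ℚ
  beyond j e<j j<1+n = trans (cong (g j *_) (shift-< d h n∸j<d)) (ℚP.*-zeroʳ (g j))
    where
    n∸j<d : n ∸ j < d
    n∸j<d = m≤n⇒n<m+o⇒n∸m<o (ℕP.≤-pred (subst (j <_) (cong suc e+d≡n) j<1+n))
                            (subst (_< j ℕ.+ d) e+d≡n (ℕP.+-monoˡ-< d e<j))
  within : ∀ j → j < suc e → term j ≡ g j * h (e ∸ j)
  within j (s≤s j≤e) = cong (g j *_) (trans (shift-≥ d h d≤n∸j) (cong h (begin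
    n ∸ j ∸ d      ≡⟨ ℕP.∸-+-assoc n j d ⟩
    n ∸ (j ℕ.+ d)  ≡⟨ cong (n ∸_) (ℕP.+-comm j d) ⟩
    n ∸ (d ℕ.+ j)  ≡⟨ ℕP.∸-+-assoc n d j ⟨
    e ∸ j          ∎)))
    where
    d≤n∸j : d ≤ n ∸ j
    d≤n∸j = subst (_≤ n ∸ j) (ℕP.m+n∸m≡n j d) (ℕP.∸-monoˡ-≤ j (subst (j ℕ.+ d ≤_) e+d≡n (ℕP.+-monoˡ-≤ d j≤e)))

⊛-congʳ : ∀ f {g h : Series} → (∀ m → g m ≡ h m) → ∀ n → (f ⊛ g) n ≡ (f ⊛ h) n
⊛-congʳ f g≗h n = Σ<-cong′ (suc n) (λ i → cong (f i *_) (g≗h (n ∸ i)))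

⊛-distribʳ-+ : ∀ f g h n → ((λ j → f j + g j) ⊛ h) n ≡ (f ⊛ h) n + (g ⊛ h) n
⊛-distribʳ-+ f g h n = trans (Σ<-cong′ (suc n) (λ i → ℚP.*-distribʳ-+ (h (n ∸ i)) (f i) (g i)))
                             (Σ<-distrib-+ (suc n) _ _)

⊛-scaleʳ : ∀ f c h n → (f ⊛ (λ m → c * h m)) n ≡ c * (f ⊛ h) n
⊛-scaleʳ f c h n = trans (Σ<-cong′ (suc n) (λ i → exchange (f i) (h (n ∸ i)))) (sym (*-distribˡ-Σ< (suc n) c _))
  where
  exchange : ∀ x y → x * (c * y) ≡ c * (x * y)
  exchange x y = solve 3 (λ x c y → x :* (c :* y) := c :* (x :* y)) refl x c y

⊛-Σ<ʳ : ∀ f r (H : ℕ → Series) n → (f ⊛ (λ m → Σ< r (λ i → H i m))) n ≡ Σ< r (λ i → (f ⊛ H i) n)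
⊛-Σ<ʳ f r H n = trans (Σ<-cong′ (suc n) (λ j → *-distribˡ-Σ< r (f j) _)) (Σ<-comm (suc n) r _)

Σ<-pascal : ∀ k (V : ℕ → ℚ) →
  Σ< (suc k) (λ i → ℕ→ℚ (k C i) * V (suc i)) + Σ< (suc k) (λ i → ℕ→ℚ (k C i) * V i)
    ≡ Σ< (suc (suc k)) (λ i → ℕ→ℚ (suc k C i) * V i)
Σ<-pascal k V = begin
  S + Σ< (suc k) (λ i → c i * V i)
    ≡⟨ cong (S +_) (Σ<-suc k (λ i → c i * V i)) ⟩
  S + (1ℚ * V 0 + T)
    ≡⟨ solve 4 (λ s v t w → s :+ (con 1ℚ :* v :+ t) := con 1ℚ :* v :+ (s :+ (t :+ con 0ℚ :* w)))
               refl S (V 0) T (V (suc k)) ⟩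
  1ℚ * V 0 + (S + (T + 0ℚ * V (suc k)))
    ≡⟨ cong (λ z → 1ℚ * V 0 + (S + (T + ℕ→ℚ z * V (suc k)))) (k>n⇒nCk≡0 (ℕP.n<1+n k)) ⟨
  1ℚ * V 0 + (S + Σ< (suc k) (λ i → c (suc i) * V (suc i)))
    ≡⟨ cong (1ℚ * V 0 +_) (Σ<-distrib-+ (suc k) _ _) ⟨
  1ℚ * V 0 + Σ< (suc k) (λ i → c i * V (suc i) + c (suc i) * V (suc i))
    ≡⟨ cong (1ℚ * V 0 +_) (Σ<-cong′ (suc k) pascal) ⟩
  1ℚ * V 0 + Σ< (suc k) (λ i → ℕ→ℚ (suc k C suc i) * V (suc i))
    ≡⟨ Σ<-suc (suc k) _ ⟨
  Σ< (suc (suc k)) (λ i → ℕ→ℚ (suc k C i) * V i)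
    ∎
  where
  c : ℕ → ℚ
  c i = ℕ→ℚ (k C i)
  S = Σ< (suc k) (λ i → c i * V (suc i))
  T = Σ< k (λ i → c (suc i) * V (suc i))
  pascal : ∀ i → c i * V (suc i) + c (suc i) * V (suc i) ≡ ℕ→ℚ (suc k C suc i) * V (suc i)
  pascal i = begin
    c i * V (suc i) + c (suc i) * V (suc i)   ≡⟨ ℚP.*-distribʳ-+ (V (suc i)) (c i) (c (suc i)) ⟨
    (c i + c (suc i)) * V (suc i)             ≡⟨ cong (_* V (suc i)) (ℕ→ℚ-+ (k C i) (k C suc i)) ⟨
    ℕ→ℚ (k C i ℕ.+ k C suc i) * V (suc i)     ≡⟨ cong (λ z → ℕ→ℚ z * V (suc i)) (nCk+nC[k+1]≡[n+1]C[k+1] k i) ⟩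
    ℕ→ℚ (suc k C suc i) * V (suc i)           ∎

binomial-monomial : ∀ a s (g : Series) k n →
  spow (λ j → monomial a s j + g j) k n
    ≡ Σ< (suc k) (λ i → ℕ→ℚ (k C i) * (a ^ i * shift (s ℕ.* i) (spow g (k ∸ i)) n))
binomial-monomial a s g zero n = begin
  spow (λ j → monomial a s j + g j) 0 n
    ≡⟨ spow-0-indep _ g n ⟩
  spow g 0 n
    ≡⟨ solve 1 (λ x → x := con 0ℚ :+ con 1ℚ :* (con 1ℚ :* x)) refl (spow g 0 n) ⟩
  0ℚ + 1ℚ * (1ℚ * shift 0 (spow g 0) n)
    ≡⟨ cong (λ d → 0ℚ + 1ℚ * (1ℚ * shift d (spow g 0) n)) (ℕP.*-zeroʳ s) ⟨
  0ℚ + 1ℚ * (1ℚ * shift (s ℕ.* 0) (spow g 0) n)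
    ∎
binomial-monomial a s g (suc k) n = begin
  spow F (suc k) n                                                    ≡⟨ ⊛-distribʳ-+ (monomial a s) g (spow F k) n ⟩
  (monomial a s ⊛ spow F k) n + (g ⊛ spow F k) n                      ≡⟨ cong₂ _+_ monomial-part g-part ⟩
  Σ< (suc k) (λ i → c i * V (suc i)) + Σ< (suc k) (λ i → c i * V i)   ≡⟨ Σ<-pascal k V ⟩
  Σ< (suc (suc k)) (λ i → ℕ→ℚ (suc k C i) * V i)                      ∎
  where
  F : Series
  F j = monomial a s j + g j
  c : ℕ → ℚ
  c i = ℕ→ℚ (k C i)
  V : ℕ → ℚ
  V i = a ^ i * shift (s ℕ.* i) (spow g (suc k ∸ i)) n
  H : ℕ → Series
  H i m = c i * (a ^ i * shift (s ℕ.* i) (spow g (k ∸ i)) m)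
  IH : ∀ m → spow F k m ≡ Σ< (suc k) (λ i → H i m)
  IH = binomial-monomial a s g k

  monomial-part : (monomial a s ⊛ spow F k) n ≡ Σ< (suc k) (λ i → c i * V (suc i))
  monomial-part = begin
    (monomial a s ⊛ spow F k) n              ≡⟨ monomial-⊛ a s (spow F k) n ⟩
    a * shift s (spow F k) n                 ≡⟨ cong (a *_) (trans (shift-cong s IH n) (shift-Σ< s (suc k) H n)) ⟩
    a * Σ< (suc k) (λ i → shift s (H i) n)   ≡⟨ *-distribˡ-Σ< (suc k) a _ ⟩
    Σ< (suc k) (λ i → a * shift s (H i) n)   ≡⟨ Σ<-cong′ (suc k) raise ⟩
    Σ< (suc k) (λ i → c i * V (suc i))       ∎
    where
    raise : ∀ i → a * shift s (H i) n ≡ c i * V (suc i)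
    raise i = begin
      a * shift s (H i) n
        ≡⟨ cong (a *_) (trans (shift-scale s (c i) (λ m → a ^ i * shift (s ℕ.* i) G m) n)
                              (cong (c i *_) (shift-scale s (a ^ i) (shift (s ℕ.* i) G) n))) ⟩
      a * (c i * (a ^ i * shift s (shift (s ℕ.* i) G) n))
        ≡⟨ cong (λ z → a * (c i * (a ^ i * z))) (shift-shift s (s ℕ.* i) G n) ⟩
      a * (c i * (a ^ i * shift (s ℕ.+ s ℕ.* i) G n))
        ≡⟨ cong (λ d → a * (c i * (a ^ i * shift d G n))) (ℕP.*-suc s i) ⟨
      a * (c i * (a ^ i * shift (s ℕ.* suc i) G n))
        ≡⟨ solve 4 (λ a c p x → a :* (c :* (p :* x)) := c :* ((a :* p) :* x)) refl a (c i) (a ^ i) _ ⟩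
      c i * V (suc i)
        ∎
      where
      G = spow g (k ∸ i)

  g-part : (g ⊛ spow F k) n ≡ Σ< (suc k) (λ i → c i * V i)
  g-part = begin
    (g ⊛ spow F k) n                 ≡⟨ trans (⊛-congʳ g IH n) (⊛-Σ<ʳ g (suc k) H n) ⟩
    Σ< (suc k) (λ i → (g ⊛ H i) n)   ≡⟨ Σ<-cong (suc k) absorb ⟩
    Σ< (suc k) (λ i → c i * V i)     ∎
    where
    absorb : ∀ i → i < suc k → (g ⊛ H i) n ≡ c i * V i
    absorb i (s≤s i≤k) = begin
      (g ⊛ H i) n
        ≡⟨ trans (⊛-scaleʳ g (c i) (λ m → a ^ i * shift (s ℕ.* i) G m) n)
                 (cong (c i *_) (⊛-scaleʳ g (a ^ i) (shift (s ℕ.* i) G) n)) ⟩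
      c i * (a ^ i * (g ⊛ shift (s ℕ.* i) G) n)
        ≡⟨ cong (λ z → c i * (a ^ i * z)) (⊛-shift g (s ℕ.* i) G n) ⟩
      c i * (a ^ i * shift (s ℕ.* i) (spow g (suc (k ∸ i))) n)
        ≡⟨ cong (λ m → c i * (a ^ i * shift (s ℕ.* i) (spow g m) n)) (ℕP.+-∸-assoc 1 i≤k) ⟨
      c i * V i
        ∎
      where
      G = spow g (k ∸ i)

-- Partial Bell polynomials

+-≡ᵇ-∸ : ∀ {i k} a → i ≤ k → (i ℕ.+ a ≡ᵇ k) ≡ (a ≡ᵇ k ∸ i)
+-≡ᵇ-∸ {i} {k} a i≤k with a ℕP.≟ k ∸ i
... | yes a≡k∸i = trans (dec-true (i ℕ.+ a ℕP.≟ k) (trans (cong (i ℕ.+_) a≡k∸i) (ℕP.m+[n∸m]≡n i≤k)))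
                        (sym (dec-true (a ℕP.≟ k ∸ i) a≡k∸i))
... | no a≢k∸i = trans (dec-false (i ℕ.+ a ℕP.≟ k) i+a≢k) (sym (dec-false (a ℕP.≟ k ∸ i) a≢k∸i))
  where
  i+a≢k : i ℕ.+ a ≢ k
  i+a≢k i+a≡k = a≢k∸i (trans (sym (ℕP.m+n∸m≡n i a)) (cong (_∸ i) i+a≡k))

+-≡ᵇ-> : ∀ {i k} a → ¬ i ≤ k → (i ℕ.+ a ≡ᵇ k) ≡ false
+-≡ᵇ-> {i} {k} a i≰k = dec-false (i ℕ.+ a ℕP.≟ k) (λ i+a≡k → i≰k (subst (i ≤_) i+a≡k (ℕP.m≤m+n i a)))

if-scale : ∀ (b : Bool) c x → (if b then c * x else 0ℚ) ≡ c * (if b then x else 0ℚ)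
if-scale true c x = refl
if-scale false c x = sym (ℚP.*-zeroʳ c)

sumℚ-boundedVecs-suc : ∀ m b (f : Vec ℕ (suc m) → ℚ) →
  sumℚ (map f (boundedVecs (suc m) b)) ≡ Σ< (suc b) (λ i → sumℚ (map (λ v → f (i ∷ v)) (boundedVecs m b)))
sumℚ-boundedVecs-suc m b f = begin
  sumℚ (map f (concatMap (λ i → map (i ∷_) (boundedVecs m b)) (upTo (suc b))))
    ≡⟨ sumℚ-concatMap f (λ i → map (i ∷_) (boundedVecs m b)) (upTo (suc b)) ⟩
  sumℚ (map (λ i → sumℚ (map f (map (i ∷_) (boundedVecs m b)))) (upTo (suc b)))
    ≡⟨ cong sumℚ (map-cong (λ i → cong sumℚ (sym (map-∘ (boundedVecs m b)))) (upTo (suc b))) ⟩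
  sumℚ (map (λ i → sumℚ (map (λ v → f (i ∷ v)) (boundedVecs m b))) (upTo (suc b)))
    ≡⟨ sumℚ-upTo (suc b) _ ⟩
  Σ< (suc b) (λ i → sumℚ (map (λ v → f (i ∷ v)) (boundedVecs m b)))
    ∎

egf : (ℕ → ℚ) → Series
egf x zero = 0ℚ
egf x (suc j) = x (suc j) * inv! (suc j)

window : (ℕ → ℚ) → ℕ → ℕ → Series
window x s zero j = 0ℚ
window x s (suc m) j = monomial (x s * inv! s) s j + window x (suc s) m j

window-below : ∀ x s m {j} → j < s → window x s m j ≡ 0ℚ
window-below x s zero j<s = refl
window-below x s (suc m) j<s =
  trans (cong₂ _+_ (monomial-≢ _ (ℕP.<⇒≢ j<s)) (window-below x (suc s) m (ℕP.m<n⇒m<1+n j<s)))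
        (ℚP.+-identityˡ 0ℚ)

window-inside : ∀ x s m {j} → s ≤ j → j < s ℕ.+ m → window x s m j ≡ x j * inv! j
window-inside x s zero s≤j j<s+0 = ⊥-elim (ℕP.<⇒≱ (subst (_ <_) (ℕP.+-identityʳ s) j<s+0) s≤j)
window-inside x s (suc m) {j} s≤j j<s+1+m with ℕP.m≤n⇒m<n∨m≡n s≤j
... | inj₁ s<j = trans (cong₂ _+_ (monomial-≢ _ (ℕP.>⇒≢ s<j))
                                 (window-inside x (suc s) m s<j (subst (j <_) (ℕP.+-suc s m) j<s+1+m)))
                       (ℚP.+-identityˡ _)
... | inj₂ refl = trans (cong₂ _+_ (monomial-≡ _ s) (window-below x (suc s) m ℕP.≤-refl)) (ℚP.+-identityʳ _)

-- bellSum m s k n is the Bell sum over index vectors (iₛ, …, i_{s+m-1}) with entries ≤ b.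
module BellSum (x : ℕ → ℚ) (b : ℕ) where

  summand : ℕ → ℕ → ℕ → ∀ {m} → Vec ℕ m → ℚ
  summand s k n v = if (vsum v ≡ᵇ k) ∧ (wsum s v ≡ᵇ n) then bellTerm x s v else 0ℚ

  bellSum : ℕ → ℕ → ℕ → ℕ → ℚ
  bellSum m s k n = sumℚ (map (summand s k n) (boundedVecs m b))

  leading : ℕ → ℕ → ℚ
  leading s i = (x s * inv! s) ^ i * inv! i

  bellSum-first-≤ : ∀ m s k n i → i ≤ k →
    sumℚ (map (λ v → summand s k n (i ∷ v)) (boundedVecs m b))
      ≡ leading s i * shift (s ℕ.* i) (bellSum m (suc s) (k ∸ i)) n
  bellSum-first-≤ m s k n i i≤k with s ℕ.* i ℕP.≤? n
  ... | yes si≤n = begin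
    sumℚ (map (λ v → summand s k n (i ∷ v)) L)
      ≡⟨ cong sumℚ (map-cong peel L) ⟩
    sumℚ (map (λ v → leading s i * summand (suc s) (k ∸ i) (n ∸ s ℕ.* i) v) L)
      ≡⟨ *-distribˡ-sumℚ (leading s i) _ L ⟨
    leading s i * bellSum m (suc s) (k ∸ i) (n ∸ s ℕ.* i)
      ≡⟨ cong (leading s i *_) (shift-≥ (s ℕ.* i) (bellSum m (suc s) (k ∸ i)) si≤n) ⟨
    leading s i * shift (s ℕ.* i) (bellSum m (suc s) (k ∸ i)) n
      ∎
    where
    L = boundedVecs m b
    peel : ∀ v → summand s k n (i ∷ v) ≡ leading s i * summand (suc s) (k ∸ i) (n ∸ s ℕ.* i) v
    peel v = trans (cong₂ (λ p q → if p ∧ q then leading s i * bellTerm x (suc s) v else 0ℚ)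
                          (+-≡ᵇ-∸ (vsum v) i≤k) (+-≡ᵇ-∸ (wsum (suc s) v) si≤n))
                   (if-scale _ (leading s i) (bellTerm x (suc s) v))
  ... | no si≰n = trans (sumℚ-vanishing _ (boundedVecs m b) too-heavy) (sym (begin
    leading s i * shift (s ℕ.* i) (bellSum m (suc s) (k ∸ i)) n
      ≡⟨ cong (leading s i *_) (shift-< (s ℕ.* i) (bellSum m (suc s) (k ∸ i)) (ℕP.≰⇒> si≰n)) ⟩
    leading s i * 0ℚ
      ≡⟨ ℚP.*-zeroʳ (leading s i) ⟩
    0ℚ
      ∎))
    where
    too-heavy : ∀ v → summand s k n (i ∷ v) ≡ 0ℚ
    too-heavy v = cong (λ q → if q then leading s i * bellTerm x (suc s) v else 0ℚ)
                       (trans (cong ((i ℕ.+ vsum v ≡ᵇ k) ∧_) (+-≡ᵇ-> (wsum (suc s) v) si≰n))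
                              (∧-zeroʳ (i ℕ.+ vsum v ≡ᵇ k)))

  bellSum-first-> : ∀ m s k n i → ¬ i ≤ k →
                    sumℚ (map (λ v → summand s k n (i ∷ v)) (boundedVecs m b)) ≡ 0ℚ
  bellSum-first-> m s k n i i≰k = sumℚ-vanishing _ (boundedVecs m b) too-many
    where
    too-many : ∀ v → summand s k n (i ∷ v) ≡ 0ℚ
    too-many v = cong (λ p → if p ∧ (s ℕ.* i ℕ.+ wsum (suc s) v ≡ᵇ n) then leading s i * bellTerm x (suc s) v else 0ℚ)
                      (+-≡ᵇ-> (vsum v) i≰k)

  bellSum-window : ∀ m s k n → k ≤ b → bellSum m s k n ≡ inv! k * spow (window x s m) k n
  bellSum-window zero s zero zero _ = refl
  bellSum-window zero s zero (suc n) _ = refl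
  bellSum-window zero s (suc k) n _ =
    trans (ℚP.+-identityˡ 0ℚ) (sym (trans (cong (inv! (suc k) *_) (spow-zero-series k n)) (ℚP.*-zeroʳ (inv! (suc k)))))
  bellSum-window (suc m) s k n k≤b = begin
    bellSum (suc m) s k n
      ≡⟨ sumℚ-boundedVecs-suc m b (summand s k n) ⟩
    Σ< (suc b) row
      ≡⟨ cong (λ c → Σ< (suc c) row) (ℕP.m+[n∸m]≡n k≤b) ⟨
    Σ< (suc k ℕ.+ (b ∸ k)) row
      ≡⟨ Σ<-vanishing-tail (suc k) (b ∸ k) row (λ i k<i _ → bellSum-first-> m s k n i (ℕP.<⇒≱ k<i)) ⟩
    Σ< (suc k) row
      ≡⟨ Σ<-cong (suc k) (λ i i<1+k → bellSum-first-≤ m s k n i (ℕP.≤-pred i<1+k)) ⟩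
    Σ< (suc k) (λ i → leading s i * shift (s ℕ.* i) (bellSum m (suc s) (k ∸ i)) n)
      ≡⟨ Σ<-cong (suc k) reshape ⟩
    Σ< (suc k) (λ i → inv! k * binomialTerm i)
      ≡⟨ *-distribˡ-Σ< (suc k) (inv! k) binomialTerm ⟨
    inv! k * Σ< (suc k) binomialTerm
      ≡⟨ cong (inv! k *_) (binomial-monomial a s W k n) ⟨
    inv! k * spow (window x s (suc m)) k n
      ∎
    where
    row : ℕ → ℚ
    row i = sumℚ (map (λ v → summand s k n (i ∷ v)) (boundedVecs m b))
    a = x s * inv! s
    W = window x (suc s) m
    binomialTerm : ℕ → ℚ
    binomialTerm i = ℕ→ℚ (k C i) * (a ^ i * shift (s ℕ.* i) (spow W (k ∸ i)) n)
    reshape : ∀ i → i < suc k →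
              leading s i * shift (s ℕ.* i) (bellSum m (suc s) (k ∸ i)) n ≡ inv! k * binomialTerm i
    reshape i (s≤s i≤k) = begin
      leading s i * shift (s ℕ.* i) (bellSum m (suc s) (k ∸ i)) n
        ≡⟨ cong (leading s i *_) (shift-cong (s ℕ.* i) IH n) ⟩
      leading s i * shift (s ℕ.* i) (λ n′ → inv! (k ∸ i) * spow W (k ∸ i) n′) n
        ≡⟨ cong (leading s i *_) (shift-scale (s ℕ.* i) (inv! (k ∸ i)) (spow W (k ∸ i)) n) ⟩
      a ^ i * inv! i * (inv! (k ∸ i) * X)
        ≡⟨ solve 4 (λ p I J X → p :* I :* (J :* X) := (I :* J) :* (p :* X)) refl (a ^ i) (inv! i) (inv! (k ∸ i)) X ⟩
      (inv! i * inv! (k ∸ i)) * (a ^ i * X)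
        ≡⟨ cong (_* (a ^ i * X)) (inv!-C i≤k) ⟨
      (inv! k * ℕ→ℚ (k C i)) * (a ^ i * X)
        ≡⟨ ℚP.*-assoc (inv! k) _ _ ⟩
      inv! k * binomialTerm i
        ∎
      where
      X = shift (s ℕ.* i) (spow W (k ∸ i)) n
      IH : ∀ n′ → bellSum m (suc s) (k ∸ i) n′ ≡ inv! (k ∸ i) * spow W (k ∸ i) n′
      IH n′ = bellSum-window m (suc s) (k ∸ i) n′ (ℕP.≤-trans (ℕP.m∸n≤m k i) k≤b)

bell-egf : ∀ n k x → k ≤ n → bell n k x ≡ ℕ→ℚ (n !) * inv! k * spow (egf x) k n
bell-egf n k x k≤n = begin
  bell n k x
    ≡⟨ cong sumℚ (map-cong (λ v → if-scale ((vsum v ≡ᵇ k) ∧ (wsum 1 v ≡ᵇ n)) (ℕ→ℚ (n !)) (bellTerm x 1 v)) L) ⟩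
  sumℚ (map (λ v → ℕ→ℚ (n !) * summand 1 k n v) L)
    ≡⟨ *-distribˡ-sumℚ (ℕ→ℚ (n !)) (summand 1 k n) L ⟨
  ℕ→ℚ (n !) * bellSum M 1 k n
    ≡⟨ cong (ℕ→ℚ (n !) *_) (bellSum-window M 1 k n ℕP.≤-refl) ⟩
  ℕ→ℚ (n !) * (inv! k * spow (window x 1 M) k n)
    ≡⟨ cong (λ z → ℕ→ℚ (n !) * (inv! k * z)) (spow-agree _ _ M (agree 0 z≤n) refl agree k n n<M+k) ⟩
  ℕ→ℚ (n !) * (inv! k * spow (egf x) k n)
    ≡⟨ ℚP.*-assoc (ℕ→ℚ (n !)) (inv! k) _ ⟨
  ℕ→ℚ (n !) * inv! k * spow (egf x) k n
    ∎
  where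
  open BellSum x k
  M = suc (n ∸ k)
  L = boundedVecs M k
  agree : ∀ j → j ≤ M → window x 1 M j ≡ egf x j
  agree zero _ = window-below x 1 M (s≤s z≤n)
  agree (suc j) j<M = window-inside x 1 M (s≤s z≤n) (s≤s j<M)
  n<M+k : n < M ℕ.+ k
  n<M+k = s≤s (ℕP.≤-reflexive (sym (ℕP.m∸n+n≡m k≤n)))

S2≡bell : ∀ μ n k → k ≤ n → S2 μ n k ≡ bell n k (dfall μ 1ℚ)
S2≡bell μ n k k≤n =
  sym (trans (bell-egf n k (dfall μ 1ℚ) k≤n) (cong (ℕ→ℚ (n !) * inv! k *_) (spow-cong egf≗degExpMinus1 k n)))
  where
  egf≗degExpMinus1 : ∀ j → egf (dfall μ 1ℚ) j ≡ degExpMinus1 μ j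
  egf≗degExpMinus1 zero = refl
  egf≗degExpMinus1 (suc j) = refl

-- Rescaling by λ

spow-scale : ∀ (l : ℚ) (f g : Series) → (∀ n → l ^ n * f n ≡ l * g n) →
             ∀ k n → l ^ n * spow f k n ≡ l ^ k * spow g k n
spow-scale l f g f≈lg zero zero = refl
spow-scale l f g f≈lg zero (suc n) = trans (ℚP.*-zeroʳ (l ^ suc n)) (sym (ℚP.*-zeroʳ 1ℚ))
spow-scale l f g f≈lg (suc k) n = begin
  l ^ n * (f ⊛ spow f k) n                                  ≡⟨ *-distribˡ-Σ< (suc n) (l ^ n) _ ⟩
  Σ< (suc n) (λ i → l ^ n * (f i * spow f k (n ∸ i)))       ≡⟨ Σ<-cong (suc n) term ⟩
  Σ< (suc n) (λ i → l ^ suc k * (g i * spow g k (n ∸ i)))   ≡⟨ *-distribˡ-Σ< (suc n) (l ^ suc k) _ ⟨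
  l ^ suc k * (g ⊛ spow g k) n                              ∎
  where
  interchange : ∀ a b c d → (a * b) * (c * d) ≡ (a * c) * (b * d)
  interchange = solve 4 (λ a b c d → (a :* b) :* (c :* d) := (a :* c) :* (b :* d)) refl
  term : ∀ i → i < suc n → l ^ n * (f i * spow f k (n ∸ i)) ≡ l ^ suc k * (g i * spow g k (n ∸ i))
  term i (s≤s i≤n) = begin
    l ^ n * (f i * spow f k (n ∸ i))
      ≡⟨ cong (λ m → l ^ m * (f i * spow f k (n ∸ i))) (ℕP.m+[n∸m]≡n i≤n) ⟨
    l ^ (i ℕ.+ (n ∸ i)) * (f i * spow f k (n ∸ i))
      ≡⟨ cong (_* (f i * spow f k (n ∸ i))) (^-+ l i (n ∸ i)) ⟩
    (l ^ i * l ^ (n ∸ i)) * (f i * spow f k (n ∸ i))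
      ≡⟨ interchange (l ^ i) (l ^ (n ∸ i)) (f i) (spow f k (n ∸ i)) ⟩
    (l ^ i * f i) * (l ^ (n ∸ i) * spow f k (n ∸ i))
      ≡⟨ cong₂ _*_ (f≈lg i) (spow-scale l f g f≈lg k (n ∸ i)) ⟩
    (l * g i) * (l ^ k * spow g k (n ∸ i))
      ≡⟨ interchange l (g i) (l ^ k) (spow g k (n ∸ i)) ⟩
    l ^ suc k * (g i * spow g k (n ∸ i))
      ∎

scaledFalling : ℚ → ℕ → ℚ
scaledFalling l zero = 1ℚ
scaledFalling l (suc m) = scaledFalling l m * (l - ℕ→ℚ (suc m))

scaledFalling-dfall : ∀ (l : ℚ) .{{_ : NonZero l}} m → l ^ m * dfall (1/ l) 1ℚ (suc m) ≡ scaledFalling l m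
scaledFalling-dfall l zero = solve 1 (λ μ → con 1ℚ :* (con 1ℚ :* (con 1ℚ :+ :- (con 0ℚ :* μ))) := con 1ℚ) refl (1/ l)
scaledFalling-dfall l (suc m) = begin
  l * l ^ m * (dfall (1/ l) 1ℚ (suc m) * (1ℚ - ℕ→ℚ (suc m) * 1/ l))
    ≡⟨ solve 5 (λ l p d n μ → l :* p :* (d :* (con 1ℚ :+ :- (n :* μ))) := (p :* d) :* (l :+ :- (n :* (l :* μ))))
               refl l (l ^ m) (dfall (1/ l) 1ℚ (suc m)) (ℕ→ℚ (suc m)) (1/ l) ⟩
  (l ^ m * dfall (1/ l) 1ℚ (suc m)) * (l - ℕ→ℚ (suc m) * (l * 1/ l))
    ≡⟨ cong₂ (λ a b → a * (l - ℕ→ℚ (suc m) * b)) (scaledFalling-dfall l m) (ℚP.*-inverseʳ l) ⟩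
  scaledFalling l m * (l - ℕ→ℚ (suc m) * 1ℚ)
    ≡⟨ cong (λ z → scaledFalling l m * (l - z)) (ℚP.*-identityʳ (ℕ→ℚ (suc m))) ⟩
  scaledFalling l m * (l - ℕ→ℚ (suc m))
    ∎

scaledFalling-0 : ∀ m → scaledFalling 0ℚ m ≡ sgn m * ℕ→ℚ (m !)
scaledFalling-0 zero = refl
scaledFalling-0 (suc m) = begin
  scaledFalling 0ℚ m * (0ℚ - ℕ→ℚ (suc m))
    ≡⟨ cong (_* (0ℚ - ℕ→ℚ (suc m))) (scaledFalling-0 m) ⟩
  sgn m * ℕ→ℚ (m !) * (0ℚ - ℕ→ℚ (suc m))
    ≡⟨ solve 3 (λ s f n → s :* f :* (con 0ℚ :+ :- n) := (:- con 1ℚ :* s) :* (n :* f))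
               refl (sgn m) (ℕ→ℚ (m !)) (ℕ→ℚ (suc m)) ⟩
  sgn (suc m) * (ℕ→ℚ (suc m) * ℕ→ℚ (m !))
    ≡⟨ cong (sgn (suc m) *_) (ℕ→ℚ-* (suc m) (m !)) ⟨
  sgn (suc m) * ℕ→ℚ (suc m !)
    ∎

scaledDegExp : ℚ → Series
scaledDegExp l zero = 0ℚ
scaledDegExp l (suc m) = scaledFalling l m * inv! (suc m)

degExpMinus1-scaled : ∀ (l : ℚ) .{{_ : NonZero l}} n → l ^ n * degExpMinus1 (1/ l) n ≡ l * scaledDegExp l n
degExpMinus1-scaled l zero = trans (ℚP.*-zeroʳ 1ℚ) (sym (ℚP.*-zeroʳ l))
degExpMinus1-scaled l (suc m) = begin
  l * l ^ m * (dfall (1/ l) 1ℚ (suc m) * inv! (suc m))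
    ≡⟨ solve 4 (λ l p d i → l :* p :* (d :* i) := l :* ((p :* d) :* i))
               refl l (l ^ m) (dfall (1/ l) 1ℚ (suc m)) (inv! (suc m)) ⟩
  l * ((l ^ m * dfall (1/ l) 1ℚ (suc m)) * inv! (suc m))
    ≡⟨ cong (λ z → l * (z * inv! (suc m))) (scaledFalling-dfall l m) ⟩
  l * scaledDegExp l (suc m)
    ∎

scaledDegExp-0 : ∀ n → scaledDegExp 0ℚ n ≡ logSeries n
scaledDegExp-0 zero = refl
scaledDegExp-0 (suc m) = begin
  scaledFalling 0ℚ m * inv! (suc m)     ≡⟨ cong (_* inv! (suc m)) (scaledFalling-0 m) ⟩
  sgn m * ℕ→ℚ (m !) * inv! (suc m)      ≡⟨ ℚP.*-assoc (sgn m) _ _ ⟩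
  sgn m * (ℕ→ℚ (m !) * inv! (suc m))    ≡⟨ cong (sgn m *_) (inv!-suc m) ⟩
  sgn m * ((ℤ.+ 1) ℚ./ suc m)           ∎

lipschitz-scaledDegExp : ∀ n → LipschitzAt0 (λ l → scaledDegExp l n)
lipschitz-scaledDegExp zero = lipschitz-const 0ℚ
lipschitz-scaledDegExp (suc m) = lipschitz-* (lipschitz-scaledFalling m) (lipschitz-const (inv! (suc m)))
  where
  lipschitz-scaledFalling : ∀ m → LipschitzAt0 (λ l → scaledFalling l m)
  lipschitz-scaledFalling zero = lipschitz-const 1ℚ
  lipschitz-scaledFalling (suc m) =
    lipschitz-* (lipschitz-scaledFalling m) (lipschitz-+ lipschitz-id (lipschitz-const (- ℕ→ℚ (suc m))))

S2-rescaled : ∀ (l : ℚ) .{{_ : NonZero l}} N k → k ≤ N →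
              l ^ (N ∸ k) * S2 (1/ l) N k ≡ ℕ→ℚ (N !) * inv! k * spow (scaledDegExp l) k N
S2-rescaled l N k k≤N = ^-cancelˡ l k (begin
  l ^ k * (l ^ (N ∸ k) * (A * spow D k N))
    ≡⟨ solve 4 (λ a b c d → a :* (b :* (c :* d)) := c :* ((a :* b) :* d)) refl (l ^ k) (l ^ (N ∸ k)) A (spow D k N) ⟩
  A * ((l ^ k * l ^ (N ∸ k)) * spow D k N)
    ≡⟨ cong (λ z → A * (z * spow D k N)) (trans (sym (^-+ l k (N ∸ k))) (cong (l ^_) (ℕP.m+[n∸m]≡n k≤N))) ⟩
  A * (l ^ N * spow D k N)
    ≡⟨ cong (A *_) (spow-scale l D (scaledDegExp l) (degExpMinus1-scaled l) k N) ⟩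
  A * (l ^ k * spow (scaledDegExp l) k N)
    ≡⟨ solve 3 (λ a b c → a :* (b :* c) := b :* (a :* c)) refl A (l ^ k) (spow (scaledDegExp l) k N) ⟩
  l ^ k * (A * spow (scaledDegExp l) k N)
    ∎)
  where
  A = ℕ→ℚ (N !) * inv! k
  D = degExpMinus1 (1/ l)

theorem3p5 : (N k : ℕ) → k ≤ N →
    LimAt0 (λ l → (l ^ (N ∸ k)) * S2 (1/ l) N k) (S1 N k)
    × LimAt0 (λ l → (l ^ (N ∸ k)) * bell N k (λ j → dfall (1/ l) (ℕ→ℚ 1) j)) (S1 N k)
theorem3p5 N k k≤N =
    lipschitzAt0⇒LimAt0 polynomial-lipschitz polynomial-0 (λ l → S2-rescaled l N k k≤N)
  , lipschitzAt0⇒LimAt0 polynomial-lipschitz polynomial-0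
      (λ l → trans (cong (l ^ (N ∸ k) *_) (sym (S2≡bell (1/ l) N k k≤N))) (S2-rescaled l N k k≤N))
  where
  polynomial : ℚ → ℚ
  polynomial l = ℕ→ℚ (N !) * inv! k * spow (scaledDegExp l) k N
  polynomial-lipschitz : LipschitzAt0 polynomial
  polynomial-lipschitz =
    lipschitz-* (lipschitz-const (ℕ→ℚ (N !) * inv! k)) (lipschitz-spow lipschitz-scaledDegExp k N)
  polynomial-0 : polynomial 0ℚ ≡ S1 N k
  polynomial-0 = cong (ℕ→ℚ (N !) * inv! k *_) (spow-cong scaledDegExp-0 k N)
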